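{- Let $N \ge 1$ be an integer and let $M$ be a positive divisor of $N$. Let $B$ denote the subgroup of $SL(2, \mathbb{Z}/N\mathbb{Z})$ consisting of all upper triangular elements. Then the subgroup $$\left\{\begin{pmatrix} a & b \\ Mc & d \end{pmatrix} \in SL(2, \mathbb{Z}/N\mathbb{Z}) \;:\; a,b,c,d \in \mathbb{Z}/N\mathbb{Z}\right\}$$ of $SL(2,\mathbb{Z}/N\mathbb{Z})$ (i.e. the matrices whose lower-left entry is a multiple of $M$) is generated by the matrix $\begin{pmatrix} 1 & 0 \\ M & 1 \end{pmatrix}$ together with $B$.
   Context: Here $SL(2,\mathbb{Z}/N\mathbb{Z})$ is the group of $2\times 2$ matrices with entries in $\mathbb{Z}/N\mathbb{Z}$ and determinant $1$. -}

module Defs where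

open import Data.Nat using (ℕ; zero; suc; _+_; _*_; _∸_; NonZero)
open import Data.Nat.DivMod using (_mod_)
open import Data.Fin using (Fin; toℕ)
open import Data.Product using (∃; _×_)
open import Relation.Binary.PropositionalEquality using (_≡_)

ZMod : ℕ → Set
ZMod N = Fin N

module _ (N : ℕ) .{{_ : NonZero N}} where

  [_] : ℕ → ZMod N
  [ n ] = n mod N

  _⊕_ : ZMod N → ZMod N → ZMod N
  x ⊕ y = [ toℕ x + toℕ y ]

  _⊗_ : ZMod N → ZMod N → ZMod N
  x ⊗ y = [ toℕ x * toℕ y ]

  ⊖_ : ZMod N → ZMod N
  ⊖ x = [ N ∸ toℕ x ]

  _⊝_ : ZMod N → ZMod N → ZMod N
  x ⊝ y = x ⊕ (⊖ y)

record Mat (N : ℕ) : Set where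
  constructor mat
  field
    a b c d : ZMod N

module _ {N : ℕ} .{{_ : NonZero N}} where

  det : Mat N → ZMod N
  det (mat a b c d) = _⊝_ N (_⊗_ N a d) (_⊗_ N b c)

  IsSL : Mat N → Set
  IsSL g = det g ≡ [ N ] 1

  _·_ : Mat N → Mat N → Mat N
  mat a b c d · mat a' b' c' d' =
    mat (_⊕_ N (_⊗_ N a a') (_⊗_ N b c')) (_⊕_ N (_⊗_ N a b') (_⊗_ N b d'))
        (_⊕_ N (_⊗_ N c a') (_⊗_ N d c')) (_⊕_ N (_⊗_ N c b') (_⊗_ N d d'))

  -- inverse of a determinant-one matrix
  inv : Mat N → Mat N
  inv (mat a b c d) = mat d (⊖_ N b) (⊖_ N c) a

  I₂ : Mat N
  I₂ = mat ([ N ] 1) ([ N ] 0) ([ N ] 0) ([ N ] 1)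

  InB : Mat N → Set
  InB g = IsSL g × Mat.c g ≡ [ N ] 0

  lowerM : ℕ → Mat N
  lowerM M = mat ([ N ] 1) ([ N ] 0) ([ N ] M) ([ N ] 1)

  data Gen (M : ℕ) : Mat N → Set where
    gen-L   : Gen M (lowerM M)
    gen-B   : ∀ {g} → InB g → Gen M g
    gen-one : Gen M I₂
    gen-mul : ∀ {g h} → Gen M g → Gen M h → Gen M (g · h)
    gen-inv : ∀ {g} → Gen M g → Gen M (inv g)

  InΓ : ℕ → Mat N → Set
  InΓ M g = IsSL g × ∃ λ (c : ZMod N) → Mat.c g ≡ _⊗_ N ([ N ] M) c

{-# OPTIONS --safe #-}

-- Work with integer lifts: an element of Γ is the reduction of an integer matrix (a b; c d) with
-- ad − bc ≡ 1 and c ≡ M z (mod N). As no k > 1 divides a, c and N, some u = a + t c is a unit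
-- modulo N, say v u ≡ 1, and then modulo N
--   (a b; c d) = (1 −t; 0 1) · (1 0; c v 1) · (u  b + t d; 0  d − c v (b + t d)),
-- where the outer factors lie in B and (1 0; c v 1) = (1 0; M 1)^(z v). Conversely, the generators
-- lie in Γ, which is closed under products and inverses because M ℤ is an ideal.

module Submission where

open import Defs
open import Data.Nat using (ℕ; zero; suc; NonZero; _≥_)
open import Data.Nat.Divisibility using (_∣_; ∣1⇒≡1)
open import Data.Product using (∃-syntax; _×_; _,_)

module CoprimeTranslation where

  open import Data.Nat as ℕ using (_+_; _*_; _^_; _<_)
  open import Data.Nat.Properties using (*-identityˡ; +-comm; *-comm; *-assoc; *-distribʳ-+)
  open import Data.Nat.Divisibility
    using (∣-refl; ∣-trans; ∣m+n∣m⇒∣n; ∣m⇒∣m*n; ∣n⇒∣m*n; *-pres-∣; 0∣⇒≡0; quotient; quotient≢0; quotient-<)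
  open import Data.Nat.GCD using (gcd; gcd[m,n]∣m; gcd[m,n]∣n)
  open import Data.Nat.Coprimality using (Coprime; gcd≡1⇒coprime; coprime-divisor)
  open import Data.Nat.Induction using (<-wellFounded)
  open import Induction.WellFounded using (Acc; acc)
  open import Relation.Binary.PropositionalEquality using (_≡_; sym; trans; cong; subst; module ≡-Reasoning)
  open import Relation.Nullary using (contradiction)

  record Splitting (a n : ℕ) : Set where
    constructor mkSplitting
    field
      n₁ n₂ k    : ℕ
      n≡n₁*n₂    : n ≡ n₁ * n₂
      n₁∣a^k     : n₁ ∣ a ^ k
      coprime-n₂ : Coprime n₂ a

  splitting-acc : ∀ a n .{{_ : NonZero n}} → Acc _<_ n → Splitting a n
  splitting-acc a n (acc rec) with gcd n a in gcd≡ | gcd[m,n]∣m n a | gcd[m,n]∣n n a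
  ... | 0 | 0∣n | _ = contradiction (0∣⇒≡0 0∣n) (ℕ.≢-nonZero⁻¹ n)
  ... | 1 | _ | _ = mkSplitting 1 n 0 (sym (*-identityˡ n)) ∣-refl (gcd≡1⇒coprime gcd≡)
  ... | g@(suc (suc _)) | g∣n | g∣a =
    let instance _ = quotient≢0 g∣n
        mkSplitting m₁ m₂ k q≡m₁*m₂ m₁∣a^k coprime-m₂ = splitting-acc a (quotient g∣n) (rec (quotient-< g∣n))
    in mkSplitting (g * m₁) m₂ (suc k) (n≡g*m₁*m₂ m₁ m₂ q≡m₁*m₂) (*-pres-∣ g∣a m₁∣a^k) coprime-m₂
    where
    open ≡-Reasoning
    n≡g*m₁*m₂ : ∀ m₁ m₂ → quotient g∣n ≡ m₁ * m₂ → n ≡ g * m₁ * m₂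
    n≡g*m₁*m₂ m₁ m₂ q≡m₁*m₂ = begin
      n                 ≡⟨ _∣_.equality g∣n ⟩
      quotient g∣n * g  ≡⟨ cong (_* g) q≡m₁*m₂ ⟩
      m₁ * m₂ * g       ≡⟨ *-comm (m₁ * m₂) g ⟩
      g * (m₁ * m₂)     ≡⟨ *-assoc g m₁ m₂ ⟨
      g * m₁ * m₂       ∎

  splitting : ∀ a n .{{_ : NonZero n}} → Splitting a n
  splitting a n = splitting-acc a n (<-wellFounded n)

  coprime-* : ∀ {d m n} → Coprime d m → Coprime d n → Coprime d (m * n)
  coprime-* d⊥m d⊥n (e∣d , e∣mn) =
    d⊥n (e∣d , coprime-divisor (λ (f∣e , f∣m) → d⊥m (∣-trans f∣e e∣d , f∣m)) e∣mn)

  ∣m+n∧∣mʲ⇒≡1 : ∀ d m n j → Coprime d n → d ∣ m + n → d ∣ m ^ j → d ≡ 1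
  ∣m+n∧∣mʲ⇒≡1 d m n zero    d⊥n d∣m+n d∣1 = ∣1⇒≡1 d∣1
  ∣m+n∧∣mʲ⇒≡1 d m n (suc j) d⊥n d∣m+n d∣m^[1+j] =
    ∣m+n∧∣mʲ⇒≡1 d m n j d⊥n d∣m+n (coprime-divisor d⊥n (∣m+n∣m⇒∣n d∣[m+n]mʲ d∣m^[1+j]))
    where
    d∣[m+n]mʲ : d ∣ m * m ^ j + n * m ^ j
    d∣[m+n]mʲ = subst (d ∣_) (*-distribʳ-+ (m ^ j) m n) (∣m⇒∣m*n (m ^ j) d∣m+n)

  -- Write n = n₁ n₂ with n₁ ∣ aᵏ and n₂ coprime to a, and take t = n₂: a common divisor d
  -- of a + n₂ c and n is coprime to n₂ and to c, hence divides n₁ ∣ aᵏ, hence is 1.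
  ∃-coprime-translate : ∀ a c n .{{_ : NonZero n}} →
    (∀ {d} → d ∣ a → d ∣ c → d ∣ n → d ≡ 1) → ∃[ t ] Coprime (a + t * c) n
  ∃-coprime-translate a c n a⊥c⊥n with splitting a n
  ... | mkSplitting n₁ n₂ k n≡n₁*n₂ n₁∣a^k n₂⊥a = n₂ , λ {d} → d≡1 d
    where
    ∣a : ∀ {e} → e ∣ a + n₂ * c → e ∣ n₂ * c → e ∣ a
    ∣a {e} e∣a+n₂c = ∣m+n∣m⇒∣n (subst (e ∣_) (+-comm a (n₂ * c)) e∣a+n₂c)

    d≡1 : ∀ d → d ∣ a + n₂ * c × d ∣ n → d ≡ 1
    d≡1 d (d∣a+n₂c , d∣n) = ∣m+n∧∣mʲ⇒≡1 d a (n₂ * c) k (coprime-* d⊥n₂ d⊥c) d∣a+n₂c (∣-trans d∣n₁ n₁∣a^k)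
      where
      d⊥n₂ : Coprime d n₂
      d⊥n₂ (e∣d , e∣n₂) = n₂⊥a (e∣n₂ , ∣a (∣-trans e∣d d∣a+n₂c) (∣m⇒∣m*n c e∣n₂))
      d⊥c : Coprime d c
      d⊥c (e∣d , e∣c) = a⊥c⊥n (∣a (∣-trans e∣d d∣a+n₂c) (∣n⇒∣m*n n₂ e∣c)) e∣c (∣-trans e∣d d∣n)
      d∣n₁ : d ∣ n₁
      d∣n₁ = coprime-divisor d⊥n₂ (subst (d ∣_) (trans n≡n₁*n₂ (*-comm n₁ n₂)) d∣n)

open CoprimeTranslation using (∃-coprime-translate)

import Data.Nat as ℕ
import Data.Nat.Properties as ℕ
open import Data.Nat.DivMod using ([m+kn]%n≡m%n; m<n⇒m%n≡m)
open import Data.Nat.Coprimality using (Coprime; coprime-Bézout)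
open import Data.Nat.GCD using (module Bézout)
open import Data.Integer as ℤ using (ℤ; +_; -[1+_]; 0ℤ; 1ℤ; _+_; _*_; -_; _-_; _/ℕ_)
open import Data.Integer.Properties
  using (neg-distribˡ-*; neg-distribʳ-*; +-identityˡ; *-identityʳ; *-zeroʳ; *-assoc; *-suc; pos-+; pos-*; +-injective; ⊖-≥; m-n≡m⊖n)
open import Data.Integer.DivMod using (n%ℕd<d; a≡a%ℕn+[a/ℕn]*n)
open import Data.Integer.Divisibility.Signed using (∣ᵤ⇒∣; ∣⇒∣ᵤ; ∣m∣n⇒∣m-n; ∣m⇒∣m*n; ∣n⇒∣m*n) renaming (_∣_ to _∣ℤ_)
open import Data.Integer.Tactic.RingSolver using (solve; solve-∀)
open import Data.Fin using (toℕ; fromℕ<)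
open import Data.Fin.Properties using (toℕ-injective; toℕ-fromℕ<; toℕ<n)
open import Data.List using (_∷_; [])
open import Function.Definitions using (Congruent; Injective)
open import Level using (0ℓ)
open import Relation.Binary.Bundles using (Setoid)
open import Relation.Binary.Structures using (IsEquivalence)
open import Relation.Binary.PropositionalEquality as ≡
  using (_≡_; refl; sym; trans; cong; cong₂; module ≡-Reasoning)
import Relation.Binary.Reasoning.Setoid as SetoidReasoning

module Congruence (n : ℤ) where

  infix 4 _≈_
  record _≈_ (x y : ℤ) : Set where
    constructor _,_
    field
      quotient : ℤ
      x≡y+qn   : x ≡ y + quotient * n

  ≈-refl : ∀ {x} → x ≈ x
  ≈-refl {x} = 0ℤ , solve (x ∷ n ∷ [])

  ≡⇒≈ : ∀ {x y} → x ≡ y → x ≈ y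
  ≡⇒≈ refl = ≈-refl

  ≈-sym : ∀ {x y} → x ≈ y → y ≈ x
  ≈-sym {x} {y} (q , x≡y+qn) = - q , (begin
    y                    ≡⟨ solve (y ∷ q ∷ n ∷ []) ⟩
    y + q * n + - q * n  ≡⟨ cong (λ w → w + - q * n) x≡y+qn ⟨
    x + - q * n          ∎)
    where open ≡-Reasoning

  ≈-trans : ∀ {x y z} → x ≈ y → y ≈ z → x ≈ z
  ≈-trans {z = z} (p , refl) (q , refl) = q + p , solve (z ∷ p ∷ q ∷ n ∷ [])

  +-cong : ∀ {x x′ y y′} → x ≈ x′ → y ≈ y′ → x + y ≈ x′ + y′
  +-cong {x′ = x′} {y′ = y′} (p , refl) (q , refl) = p + q , solve (x′ ∷ y′ ∷ p ∷ q ∷ n ∷ [])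

  *-cong : ∀ {x x′ y y′} → x ≈ x′ → y ≈ y′ → x * y ≈ x′ * y′
  *-cong {x′ = x′} {y′ = y′} (p , refl) (q , refl) =
    p * y′ + x′ * q + p * q * n , solve (x′ ∷ y′ ∷ p ∷ q ∷ n ∷ [])

  -‿cong : ∀ {x x′} → x ≈ x′ → - x ≈ - x′
  -‿cong {x′ = x′} (p , refl) = - p , solve (x′ ∷ p ∷ n ∷ [])

  n≈0 : n ≈ 0ℤ
  n≈0 = 1ℤ , solve (n ∷ [])

  +-absorbˡ : ∀ {e} → e ≈ 0ℤ → ∀ x y → x + y * e ≈ x
  +-absorbˡ (q , refl) x y = y * q , solve (x ∷ y ∷ q ∷ n ∷ [])

  ≈-isEquivalence : IsEquivalence _≈_
  ≈-isEquivalence = record { refl = ≈-refl ; sym = ≈-sym ; trans = ≈-trans }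

  ≈-setoid : Setoid 0ℓ 0ℓ
  ≈-setoid = record { isEquivalence = ≈-isEquivalence }

  module ≈-Reasoning = SetoidReasoning ≈-setoid

module _ (N : ℕ) .{{_ : NonZero N}} where

  open Congruence (+ N)

  lift : ZMod N → ℤ
  lift x = + toℕ x

  reduce : ℤ → ZMod N
  reduce z = fromℕ< (n%ℕd<d z N)

  ≈-lift-reduce : ∀ z → z ≈ lift (reduce z)
  ≈-lift-reduce z = z /ℕ N , ≡.subst (λ r → z ≡ + r + (z /ℕ N) * + N)
    (sym (toℕ-fromℕ< (n%ℕd<d z N))) (a≡a%ℕn+[a/ℕn]*n z N)

  private
    lift-injective⁺ : ∀ {x y} k → lift x ≡ lift y + + k * + N → x ≡ y
    lift-injective⁺ {x} {y} k eq = toℕ-injective (begin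
      toℕ x                      ≡⟨ m<n⇒m%n≡m (toℕ<n x) ⟨
      toℕ x ℕ.% N                ≡⟨ cong (ℕ._% N) x≡y+kN ⟩
      (toℕ y ℕ.+ k ℕ.* N) ℕ.% N  ≡⟨ [m+kn]%n≡m%n (toℕ y) k N ⟩
      toℕ y ℕ.% N                ≡⟨ m<n⇒m%n≡m (toℕ<n y) ⟩
      toℕ y                      ∎)
      where
      open ≡-Reasoning
      x≡y+kN : toℕ x ≡ toℕ y ℕ.+ k ℕ.* N
      x≡y+kN = +-injective (trans eq (trans (cong (λ w → lift y + w) (sym (pos-* k N))) (sym (pos-+ (toℕ y) (k ℕ.* N)))))

  lift-injective : Injective _≡_ _≈_ lift
  lift-injective (+ k , eq) = lift-injective⁺ k eq
  lift-injective x≈y@(-[1+ k ] , _) = sym (lift-injective⁺ (suc k) (_≈_.x≡y+qn (≈-sym x≈y)))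

  reduce-cong : Congruent _≈_ _≡_ reduce
  reduce-cong {x} {y} x≈y = lift-injective (≈-trans (≈-sym (≈-lift-reduce x)) (≈-trans x≈y (≈-lift-reduce y)))

  reduce-injective : Injective _≈_ _≡_ reduce
  reduce-injective {x} {y} eq = ≈-trans (≈-lift-reduce x) (≈-trans (≡⇒≈ (cong lift eq)) (≈-sym (≈-lift-reduce y)))

  reduce-lift : ∀ x → reduce (lift x) ≡ x
  reduce-lift x = sym (lift-injective (≈-lift-reduce (lift x)))

  reduce-+ : ∀ x y → reduce (x + y) ≡ _⊕_ N (reduce x) (reduce y)
  reduce-+ x y = begin
    reduce (x + y)                                ≡⟨ reduce-cong (+-cong (≈-lift-reduce x) (≈-lift-reduce y)) ⟩
    reduce (lift (reduce x) + lift (reduce y))    ≡⟨ cong reduce (pos-+ (toℕ (reduce x)) (toℕ (reduce y))) ⟨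
    _⊕_ N (reduce x) (reduce y)                   ∎
    where open ≡-Reasoning

  reduce-* : ∀ x y → reduce (x * y) ≡ _⊗_ N (reduce x) (reduce y)
  reduce-* x y = begin
    reduce (x * y)                                ≡⟨ reduce-cong (*-cong (≈-lift-reduce x) (≈-lift-reduce y)) ⟩
    reduce (lift (reduce x) * lift (reduce y))    ≡⟨ cong reduce (pos-* (toℕ (reduce x)) (toℕ (reduce y))) ⟨
    _⊗_ N (reduce x) (reduce y)                   ∎
    where open ≡-Reasoning

  reduce-neg : ∀ x → reduce (- x) ≡ ⊖_ N (reduce x)
  reduce-neg x = begin
    reduce (- x)                        ≡⟨ cong reduce (+-identityˡ (- x)) ⟨
    reduce (0ℤ + - x)                   ≡⟨ reduce-cong (≈-sym (+-cong n≈0 (-‿cong (≈-sym (≈-lift-reduce x))))) ⟩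
    reduce (+ N - lift (reduce x))      ≡⟨ cong reduce (trans (m-n≡m⊖n N r) (⊖-≥ (ℕ.<⇒≤ (toℕ<n (reduce x))))) ⟩
    reduce (+ (N ℕ.∸ r))                ≡⟨⟩
    ⊖_ N (reduce x)                     ∎
    where
    open ≡-Reasoning
    r = toℕ (reduce x)

  private
    mat-cong : ∀ {a a′ b b′ c c′ d d′ : ZMod N} →
      a ≡ a′ → b ≡ b′ → c ≡ c′ → d ≡ d′ → mat a b c d ≡ mat a′ b′ c′ d′
    mat-cong refl refl refl refl = refl

    reduce-*+* : ∀ x y z w → reduce (x * y + z * w) ≡ _⊕_ N (_⊗_ N (reduce x) (reduce y)) (_⊗_ N (reduce z) (reduce w))
    reduce-*+* x y z w = trans (reduce-+ (x * y) (z * w)) (cong₂ (_⊕_ N) (reduce-* x y) (reduce-* z w))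

  -- Opaque so that unification can read the integer entries off ⟪ a , b , c , d ⟫.
  opaque
    ⟪_,_,_,_⟫ : ℤ → ℤ → ℤ → ℤ → Mat N
    ⟪ a , b , c , d ⟫ = mat (reduce a) (reduce b) (reduce c) (reduce d)

  upper lower : ℤ → Mat N
  upper x = ⟪ 1ℤ , x , 0ℤ , 1ℤ ⟫
  lower x = ⟪ 1ℤ , 0ℤ , x , 1ℤ ⟫

  opaque
    unfolding ⟪_,_,_,_⟫

    ⟪⟫-cong : ∀ {a a′ b b′ c c′ d d′} → a ≈ a′ → b ≈ b′ → c ≈ c′ → d ≈ d′ → ⟪ a , b , c , d ⟫ ≡ ⟪ a′ , b′ , c′ , d′ ⟫
    ⟪⟫-cong a≈a′ b≈b′ c≈c′ d≈d′ = mat-cong (reduce-cong a≈a′) (reduce-cong b≈b′) (reduce-cong c≈c′) (reduce-cong d≈d′)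

    ⟪⟫-lift : ∀ g → ⟪ lift (Mat.a g) , lift (Mat.b g) , lift (Mat.c g) , lift (Mat.d g) ⟫ ≡ g
    ⟪⟫-lift (mat a b c d) = mat-cong (reduce-lift a) (reduce-lift b) (reduce-lift c) (reduce-lift d)

    c-⟪⟫ : ∀ a b c d → Mat.c ⟪ a , b , c , d ⟫ ≡ reduce c
    c-⟪⟫ a b c d = refl

    lowerM≡lower : ∀ k → lowerM k ≡ lower (+ k)
    lowerM≡lower k = refl

    ⟪⟫-· : ∀ {a b c d a′ b′ c′ d′} → ⟪ a , b , c , d ⟫ · ⟪ a′ , b′ , c′ , d′ ⟫ ≡
           ⟪ a * a′ + b * c′ , a * b′ + b * d′ , c * a′ + d * c′ , c * b′ + d * d′ ⟫
    ⟪⟫-· {a} {b} {c} {d} {a′} {b′} {c′} {d′} = sym (mat-cong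
      (reduce-*+* a a′ b c′) (reduce-*+* a b′ b d′) (reduce-*+* c a′ d c′) (reduce-*+* c b′ d d′))

    inv-⟪⟫ : ∀ {a b c d} → inv ⟪ a , b , c , d ⟫ ≡ ⟪ d , - b , - c , a ⟫
    inv-⟪⟫ {b = b} {c} = mat-cong refl (sym (reduce-neg b)) (sym (reduce-neg c)) refl

    det-⟪⟫ : ∀ a b c d → det ⟪ a , b , c , d ⟫ ≡ reduce (a * d - b * c)
    det-⟪⟫ a b c d = sym (begin
      reduce (a * d - b * c)                                       ≡⟨ reduce-+ (a * d) (- (b * c)) ⟩
      _⊕_ N (reduce (a * d)) (reduce (- (b * c)))                  ≡⟨ cong₂ (_⊕_ N) (reduce-* a d) (reduce-neg (b * c)) ⟩
      _⊕_ N (_⊗_ N (reduce a) (reduce d)) (⊖_ N (reduce (b * c)))  ≡⟨ cong (λ w → _⊝_ N (_⊗_ N (reduce a) (reduce d)) w) (reduce-* b c) ⟩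
      det ⟪ a , b , c , d ⟫                                        ∎)
      where open ≡-Reasoning

  det≈1⇒IsSL : ∀ {a b c d} → a * d - b * c ≈ 1ℤ → IsSL ⟪ a , b , c , d ⟫
  det≈1⇒IsSL {a} {b} {c} {d} det≈1 = trans (det-⟪⟫ a b c d) (reduce-cong det≈1)

  IsSL⇒det≈1 : ∀ {a b c d} → IsSL ⟪ a , b , c , d ⟫ → a * d - b * c ≈ 1ℤ
  IsSL⇒det≈1 {a} {b} {c} {d} isSL = reduce-injective (trans (sym (det-⟪⟫ a b c d)) isSL)

  upper∈B : ∀ x → InB (upper x)
  upper∈B x = det≈1⇒IsSL (≡⇒≈ (cong (λ w → 1ℤ - w) (*-zeroʳ x))) , c-⟪⟫ 1ℤ x 0ℤ 1ℤ

  lower-+ : ∀ x y → lower (x + y) ≡ lower x · lower y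
  lower-+ x y = sym (trans ⟪⟫-·
    (⟪⟫-cong (≡⇒≈ (solve (x ∷ y ∷ []))) (≡⇒≈ (solve (x ∷ y ∷ [])))
             (≡⇒≈ (solve (x ∷ y ∷ []))) (≡⇒≈ (solve (x ∷ y ∷ [])))))

  lower-neg : ∀ x → lower (- x) ≡ inv (lower x)
  lower-neg x = sym inv-⟪⟫

  ⟪⟫≡upper·⟪⟫ : ∀ t a b c d → ⟪ a , b , c , d ⟫ ≡ upper (- t) · ⟪ a + t * c , b + t * d , c , d ⟫
  ⟪⟫≡upper·⟪⟫ t a b c d = sym (trans ⟪⟫-·
    (⟪⟫-cong (≡⇒≈ (solve (t ∷ a ∷ c ∷ []))) (≡⇒≈ (solve (t ∷ b ∷ d ∷ [])))
             (≡⇒≈ (solve (t ∷ a ∷ c ∷ []))) (≡⇒≈ (solve (t ∷ b ∷ d ∷ [])))))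

  det-shear : ∀ t a b c d → (a + t * c) * d - (b + t * d) * c ≡ a * d - b * c
  det-shear t a b c d = solve (t ∷ a ∷ b ∷ c ∷ d ∷ [])

  ⟪⟫≡lower·⟪⟫ : ∀ v a b c d → v * a ≈ 1ℤ → ⟪ a , b , c , d ⟫ ≡ lower (c * v) · ⟪ a , b , 0ℤ , d - c * v * b ⟫
  ⟪⟫≡lower·⟪⟫ v a b c d va≈1 = sym (trans ⟪⟫-·
    (⟪⟫-cong (≡⇒≈ (solve (a ∷ []))) (≡⇒≈ (solve (b ∷ c ∷ d ∷ v ∷ [])))
             (c*v*a≈c) (≡⇒≈ (solve (b ∷ c ∷ d ∷ v ∷ [])))))
    where
    open ≈-Reasoning
    c*v*a≈c : c * v * a + 1ℤ * 0ℤ ≈ c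
    c*v*a≈c = begin
      c * v * a + 1ℤ * 0ℤ     ≡⟨ solve (a ∷ c ∷ v ∷ []) ⟩
      c + c * (v * a - 1ℤ)    ≈⟨ +-absorbˡ (+-cong va≈1 ≈-refl) c c ⟩
      c                       ∎

  triangular-IsSL : ∀ {a b c d v} → a * d - b * c ≈ 1ℤ → v * a ≈ 1ℤ → IsSL ⟪ a , b , 0ℤ , d - c * v * b ⟫
  triangular-IsSL {a} {b} {c} {d} {v} det≈1 va≈1 = det≈1⇒IsSL (begin
    a * (d - c * v * b) - b * 0ℤ                  ≡⟨ solve (a ∷ b ∷ c ∷ d ∷ v ∷ []) ⟩
    a * d - b * c + - (c * b) * (v * a - 1ℤ)      ≈⟨ +-absorbˡ (+-cong va≈1 ≈-refl) (a * d - b * c) (- (c * b)) ⟩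
    a * d - b * c                                 ≈⟨ det≈1 ⟩
    1ℤ                                            ∎)
    where open ≈-Reasoning

  pos-+-* : ∀ a b c → + (a ℕ.+ b ℕ.* c) ≡ + a + + b * + c
  pos-+-* a b c = trans (pos-+ a (b ℕ.* c)) (cong (λ w → + a + w) (pos-* b c))

  coprime⇒invertible : ∀ {u} → Coprime u N → ∃[ v ] v * + u ≈ 1ℤ
  coprime⇒invertible {u} u⊥N with coprime-Bézout u⊥N
  ... | Bézout.+- x y 1+yN≡xu = + x , (+ y , (begin
    + x * + u         ≡⟨ pos-* x u ⟨
    + (x ℕ.* u)       ≡⟨ cong +_ 1+yN≡xu ⟨
    + (1 ℕ.+ y ℕ.* N) ≡⟨ pos-+-* 1 y N ⟩
    1ℤ + + y * + N    ∎))
    where open ≡-Reasoning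
  ... | Bézout.-+ x y 1+xu≡yN = - + x , (- + y , (begin
    - + x * + u                ≡⟨ -x*u≡1-[1+x*u] (+ x) (+ u) ⟩
    1ℤ - (1ℤ + + x * + u)      ≡⟨ cong (λ w → 1ℤ - w) (trans (sym (pos-+-* 1 x u)) (trans (cong +_ 1+xu≡yN) (pos-* y N))) ⟩
    1ℤ - + y * + N             ≡⟨ cong (λ w → 1ℤ + w) (neg-distribˡ-* (+ y) (+ N)) ⟩
    1ℤ + - + y * + N           ∎))
    where
    open ≡-Reasoning
    -x*u≡1-[1+x*u] : ∀ x u → - x * u ≡ 1ℤ - (1ℤ + x * u)
    -x*u≡1-[1+x*u] = solve-∀

  det≈1⇒coprime-column : ∀ {a b c d} → + a * d - b * + c ≈ 1ℤ →
    ∀ {k} → k ∣ a → k ∣ c → k ∣ N → k ≡ 1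
  det≈1⇒coprime-column {a} {b} {c} {d} (q , det≡1+qN) {k} k∣a k∣c k∣N = ∣1⇒≡1 (∣⇒∣ᵤ (≡.subst (+ k ∣ℤ_) det-qN≡1
    (∣m∣n⇒∣m-n (∣m∣n⇒∣m-n (∣m⇒∣m*n d (∣ᵤ⇒∣ {i = + a} k∣a)) (∣n⇒∣m*n b (∣ᵤ⇒∣ {i = + c} k∣c))) (∣n⇒∣m*n q (∣ᵤ⇒∣ {i = + N} k∣N)))))
    where
    x+y-y≡x : ∀ x y → x + y - y ≡ x
    x+y-y≡x = solve-∀
    det-qN≡1 : + a * d - b * + c - q * + N ≡ 1ℤ
    det-qN≡1 = trans (cong (λ w → w - q * + N) det≡1+qN) (x+y-y≡x 1ℤ (q * + N))

  ⟪⟫≡upper·lower·B : ∀ {a b c d} t v → a * d - b * c ≈ 1ℤ → v * (a + t * c) ≈ 1ℤ →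
    ∃[ h ] InB h × ⟪ a , b , c , d ⟫ ≡ upper (- t) · (lower (c * v) · h)
  ⟪⟫≡upper·lower·B {a} {b} {c} {d} t v det≈1 vu≈1 =
    ⟪ a + t * c , b + t * d , 0ℤ , d - c * v * (b + t * d) ⟫ ,
    (triangular-IsSL (≈-trans (≡⇒≈ (det-shear t a b c d)) det≈1) vu≈1 , c-⟪⟫ _ _ _ _) ,
    trans (⟪⟫≡upper·⟪⟫ t a b c d) (cong (upper (- t) ·_) (⟪⟫≡lower·⟪⟫ v (a + t * c) (b + t * d) c d vu≈1))

  lower-cong : ∀ {x y} → x ≈ y → lower x ≡ lower y
  lower-cong x≈y = ⟪⟫-cong ≈-refl ≈-refl x≈y ≈-refl

  module _ (M : ℕ) where

    ⟪⟫∈Γ : ∀ {a b c d} z → a * d - b * c ≈ 1ℤ → c ≈ + M * z → InΓ M ⟪ a , b , c , d ⟫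
    ⟪⟫∈Γ {a} {b} {c} {d} z det≈1 c≈Mz =
      det≈1⇒IsSL det≈1 , reduce z , trans (c-⟪⟫ a b c d) (trans (reduce-cong c≈Mz) (reduce-* (+ M) z))

    ⟪⟫∈Γ⁻¹ : ∀ {a b c d} → InΓ M ⟪ a , b , c , d ⟫ → a * d - b * c ≈ 1ℤ × ∃[ z ] c ≈ + M * z
    ⟪⟫∈Γ⁻¹ {a} {b} {c} {d} (isSL , c₀ , c≡Mc₀) = IsSL⇒det≈1 isSL , lift c₀ , reduce-injective (begin
      reduce c                                  ≡⟨ c-⟪⟫ a b c d ⟨
      Mat.c ⟪ a , b , c , d ⟫                   ≡⟨ c≡Mc₀ ⟩
      _⊗_ N (reduce (+ M)) c₀                   ≡⟨ cong (_⊗_ N (reduce (+ M))) (reduce-lift c₀) ⟨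
      _⊗_ N (reduce (+ M)) (reduce (lift c₀))   ≡⟨ reduce-* (+ M) (lift c₀) ⟨
      reduce (+ M * lift c₀)                    ∎)
      where open ≡-Reasoning

    ⟪⟫∈Γ-· : ∀ {a b c d a′ b′ c′ d′} → InΓ M ⟪ a , b , c , d ⟫ → InΓ M ⟪ a′ , b′ , c′ , d′ ⟫ →
      InΓ M (⟪ a , b , c , d ⟫ · ⟪ a′ , b′ , c′ , d′ ⟫)
    ⟪⟫∈Γ-· {a} {b} {c} {d} {a′} {b′} {c′} {d′} g∈Γ h∈Γ =
      let det≈1 , z , c≈Mz = ⟪⟫∈Γ⁻¹ g∈Γ
          det′≈1 , z′ , c′≈Mz′ = ⟪⟫∈Γ⁻¹ h∈Γ
      in ≡.subst (InΓ M) (sym ⟪⟫-·) (⟪⟫∈Γ (z * a′ + d * z′)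
        (begin
          (a * a′ + b * c′) * (c * b′ + d * d′) - (a * b′ + b * d′) * (c * a′ + d * c′)
            ≡⟨ solve (a ∷ b ∷ c ∷ d ∷ a′ ∷ b′ ∷ c′ ∷ d′ ∷ []) ⟩
          (a * d - b * c) * (a′ * d′ - b′ * c′)  ≈⟨ *-cong det≈1 det′≈1 ⟩
          1ℤ                                     ∎)
        (begin
          c * a′ + d * c′                        ≈⟨ +-cong (*-cong c≈Mz (≈-refl {a′})) (*-cong (≈-refl {d}) c′≈Mz′) ⟩
          + M * z * a′ + d * (+ M * z′)          ≡⟨ factor-M (+ M) z a′ d z′ ⟩
          + M * (z * a′ + d * z′)                ∎))
      where
      open ≈-Reasoning
      factor-M : ∀ m z a′ d z′ → m * z * a′ + d * (m * z′) ≡ m * (z * a′ + d * z′)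
      factor-M = solve-∀

    ⟪⟫∈Γ-inv : ∀ {a b c d} → InΓ M ⟪ a , b , c , d ⟫ → InΓ M (inv ⟪ a , b , c , d ⟫)
    ⟪⟫∈Γ-inv {a} {b} {c} {d} g∈Γ =
      let det≈1 , z , c≈Mz = ⟪⟫∈Γ⁻¹ g∈Γ
      in ≡.subst (InΓ M) (sym inv-⟪⟫) (⟪⟫∈Γ (- z)
        (begin
          d * a - - b * - c  ≡⟨ solve (a ∷ b ∷ c ∷ d ∷ []) ⟩
          a * d - b * c      ≈⟨ det≈1 ⟩
          1ℤ                 ∎)
        (≈-trans (-‿cong c≈Mz) (≡⇒≈ (neg-distribʳ-* (+ M) z))))
      where open ≈-Reasoning

    InΓ-· : ∀ {g h} → InΓ M g → InΓ M h → InΓ M (g · h)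
    InΓ-· {g} {h} = ≡.subst₂ (λ g h → InΓ M g → InΓ M h → InΓ M (g · h)) (⟪⟫-lift g) (⟪⟫-lift h) ⟪⟫∈Γ-·

    InΓ-inv : ∀ {g} → InΓ M g → InΓ M (inv g)
    InΓ-inv {g} = ≡.subst (λ g → InΓ M g → InΓ M (inv g)) (⟪⟫-lift g) ⟪⟫∈Γ-inv

    lower∈Γ : ∀ {x} z → x ≈ + M * z → InΓ M (lower x)
    lower∈Γ z = ⟪⟫∈Γ z ≈-refl

    B⊆Γ : ∀ {g} → InB g → InΓ M g
    B⊆Γ (isSL , c≡0) = isSL , reduce 0ℤ , trans c≡0 (trans (cong reduce (sym (*-zeroʳ (+ M)))) (reduce-* (+ M) 0ℤ))

    Gen⊆Γ : ∀ {g} → Gen M g → InΓ M g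
    Gen⊆Γ gen-L                 = ≡.subst (InΓ M) (sym (lowerM≡lower M)) (lower∈Γ {+ M} 1ℤ (≡⇒≈ (sym (*-identityʳ (+ M)))))
    Gen⊆Γ (gen-B {g} g∈B)       = B⊆Γ {g} g∈B
    Gen⊆Γ gen-one               = ≡.subst (InΓ M) (sym (lowerM≡lower 0)) (lower∈Γ {0ℤ} 0ℤ (≡⇒≈ (sym (*-zeroʳ (+ M)))))
    Gen⊆Γ (gen-mul {g} {h} p q) = InΓ-· {g} {h} (Gen⊆Γ p) (Gen⊆Γ q)
    Gen⊆Γ (gen-inv {g} p)       = InΓ-inv {g} (Gen⊆Γ p)

    Lᵏ∈Gen : ∀ k → Gen M (lower (+ M * + k))
    Lᵏ∈Gen zero    = ≡.subst (Gen M) (trans (lowerM≡lower 0) (cong lower (sym (*-zeroʳ (+ M))))) gen-one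
    Lᵏ∈Gen (suc k) = ≡.subst (Gen M) (begin
      lowerM M · lower (+ M * + k)    ≡⟨ cong (_· lower (+ M * + k)) (lowerM≡lower M) ⟩
      lower (+ M) · lower (+ M * + k) ≡⟨ lower-+ (+ M) (+ M * + k) ⟨
      lower (+ M + + M * + k)         ≡⟨ cong lower (*-suc (+ M) (+ k)) ⟨
      lower (+ M * + suc k)           ∎) (gen-mul gen-L (Lᵏ∈Gen k))
      where open ≡-Reasoning

    Lᶻ∈Gen : ∀ z → Gen M (lower (+ M * z))
    Lᶻ∈Gen (+ k)    = Lᵏ∈Gen k
    Lᶻ∈Gen -[1+ k ] = ≡.subst (Gen M)
      (trans (sym (lower-neg (+ M * + suc k))) (cong lower (neg-distribʳ-* (+ M) (+ suc k))))
      (gen-inv (Lᵏ∈Gen (suc k)))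

    lower∈Gen : ∀ {x} z → x ≈ + M * z → Gen M (lower x)
    lower∈Gen z x≈Mz = ≡.subst (Gen M) (lower-cong (≈-sym x≈Mz)) (Lᶻ∈Gen z)

    ⟪⟫∈Γ⇒Gen : ∀ a b c d → InΓ M ⟪ + a , b , + c , d ⟫ → Gen M ⟪ + a , b , + c , d ⟫
    ⟪⟫∈Γ⇒Gen a b c d g∈Γ =
      let det≈1 , z , c≈Mz = ⟪⟫∈Γ⁻¹ g∈Γ
          t , u⊥N = ∃-coprime-translate a c N (det≈1⇒coprime-column {b = b} {d = d} det≈1)
          v , vu≈1 = coprime⇒invertible u⊥N
          h , h∈B , g≡ = ⟪⟫≡upper·lower·B (+ t) v det≈1 (≡.subst (λ u → v * u ≈ 1ℤ) (pos-+-* a t c) vu≈1)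
          cv≈Mzv = ≈-trans (*-cong c≈Mz (≈-refl {v})) (≡⇒≈ (*-assoc (+ M) z v))
      in ≡.subst (Gen M) (sym g≡)
           (gen-mul {g = upper (- + t)} (gen-B (upper∈B (- + t)))
             (gen-mul {g = lower (+ c * v)} (lower∈Gen (z * v) cv≈Mzv) (gen-B h∈B)))

    Γ⊆Gen : ∀ {g} → InΓ M g → Gen M g
    Γ⊆Gen {g} = ≡.subst (λ g → InΓ M g → Gen M g) (⟪⟫-lift g) (⟪⟫∈Γ⇒Gen _ _ _ _)

lemma3 : (N : ℕ) .{{_ : NonZero N}} (M : ℕ) → M ≥ 1 → M ∣ N →
    (g : Mat N) → (InΓ M g → Gen M g) × (Gen M g → InΓ M g)
lemma3 N M _ _ g = Γ⊆Gen N M , Gen⊆Γ N M
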